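{- Let $(\Lambda,Y)$ be an extensible graph with parameters $(t,s,\bar s)$ where $t=1$. Fix $y\in Y$, let $Y_1=\Lambda(y,1)$, $Y_2=\Lambda(y,2)$, and let $\Lambda_1,\Lambda_2$ be the subgraphs of $\Lambda$ induced on $Y_1,Y_2$. Then: (1) The edges of $\Lambda_1$ form a partition of $Y_1$ into $s$ edges $\alpha_1=\{a'_1,a''_1\},\dots,\alpha_s=\{a'_s,a''_s\}$. (2) For each $i$, letting $A'_i$ (resp. $A''_i$) be the set of points of $Y_2$ adjacent to $a'_i$ (resp. $a''_i$), $\{A'_i,A''_i\}$ is a partition of $Y_2$ into two subsets of cardinality $\bar s=2(s-1)$. (3) $\Lambda_2$ contains no triangle. (4) Every edge of $\Lambda_2$ is contained in exactly one of the sets $A'_1,A''_1,\dots,A'_s,A''_s$, and the edges of $\Lambda_2$ contained in each of these sets form a partition of that set into $s-1$ edges. (5) If $\alpha'$ and $\alpha''$ are edges of $\Lambda_2$ contained in $A'_i$ and $A''_i$ respectively, there exist uniquely determined edges $\beta',\beta''$ of $\Lambda_2$ such that $\alpha',\alpha'',\beta',\beta''$ form a square (a $4$-cycle); moreover there is a unique index $j$ such that one of $\beta',\beta''$ is contained in $A'_j$ and the other in $A''_j$.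
   Context: A simple graph $(\Lambda,Y)$ is extensible with parameters $(t,s,\bar s)$ (integers) if: (1) $\Lambda$ has diameter $2$; (2) for every $y\in Y$: (a) $|\Lambda(y,1)|=2s$, where $\Lambda(y,d)$ denotes the set of vertices at distance $d$ from $y$; (b) $|\Lambda(y,2)|=2\bar s$; (c) every $z\in\Lambda(y,1)$ is adjacent to exactly $\bar s$ points of $\Lambda(y,2)$ and exactly $t=2s-\bar s-1$ points of $\Lambda(y,1)$; (d) every $z\in\Lambda(y,2)$ is adjacent to exactly $s$ points of $\Lambda(y,2)$ and exactly $s$ points of $\Lambda(y,1)$; (3) every edge lies in exactly $t$ triangles; (4) $|Y|=1+2s+2\bar s$. -}

module Defs where

open import Data.Nat using (ℕ; zero; suc; _+_; _*_; _∸_)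
open import Data.Fin using (Fin; zero; suc; _≟_)
open import Data.Bool using (Bool; true; false; T; _∧_; _∨_; not; if_then_else_)
open import Relation.Nullary.Decidable using (⌊_⌋)
open import Data.Product using (Σ; ∃; ∃₂; _×_; _,_; proj₁; proj₂)
open import Data.Sum using (_⊎_)
open import Data.Empty using (⊥)
open import Relation.Nullary using (¬_)
open import Relation.Binary.PropositionalEquality using (_≡_; _≢_)

count : ∀ {n} → (Fin n → Bool) → ℕ
count {zero}  p = 0
count {suc n} p = (if p zero then 1 else 0) + count (λ i → p (suc i))

anyF : ∀ {n} → (Fin n → Bool) → Bool
anyF {zero}  p = false
anyF {suc n} p = p zero ∨ anyF (λ i → p (suc i))

record SimpleGraph (n : ℕ) : Set where
  field
    adj    : Fin n → Fin n → Bool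
    sym    : ∀ u v → adj u v ≡ adj v u
    irrefl : ∀ u → adj u u ≡ false

module _ {n : ℕ} (G : SimpleGraph n) where
  open SimpleGraph G

  dist1 : Fin n → Fin n → Bool
  dist1 y z = adj y z

  dist2 : Fin n → Fin n → Bool
  dist2 y z = not ⌊ y ≟ z ⌋ ∧ (not (adj y z) ∧ anyF (λ w → adj y w ∧ adj w z))

  Diameter2 : Set
  Diameter2 = (∀ u v → u ≡ v ⊎ (T (dist1 u v) ⊎ T (dist2 u v)))
            × ∃₂ (λ u v → T (dist2 u v))

  -- extensible with parameters (t, s, s̄); t = 2s - s̄ - 1 written additively
  record IsExtensible (t s s̄ : ℕ) : Set where
    field
      t-def    : t + s̄ + 1 ≡ 2 * s
      diam     : Diameter2
      card1    : ∀ y → count (dist1 y) ≡ 2 * s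
      card2    : ∀ y → count (dist2 y) ≡ 2 * s̄
      nbr1-2   : ∀ y z → T (dist1 y z) → count (λ w → adj z w ∧ dist2 y w) ≡ s̄
      nbr1-1   : ∀ y z → T (dist1 y z) → count (λ w → adj z w ∧ dist1 y w) ≡ t
      nbr2-2   : ∀ y z → T (dist2 y z) → count (λ w → adj z w ∧ dist2 y w) ≡ s
      nbr2-1   : ∀ y z → T (dist2 y z) → count (λ w → adj z w ∧ dist1 y w) ≡ s
      triangles : ∀ u v → T (adj u v) → count (λ w → adj u w ∧ adj v w) ≡ t
      cardY    : n ≡ 1 + 2 * s + 2 * s̄

  -- the edges of Λ inside P form a partition of P into m edges
  -- {pt true i, pt false i}, i : Fin m
  record EdgePartition (P : Fin n → Bool) (m : ℕ) : Set where
    field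
      pt     : Bool → Fin m → Fin n
      pt-inj : ∀ x i x' i' → pt x i ≡ pt x' i' → (x ≡ x' × i ≡ i')
      pt-in  : ∀ x i → T (P (pt x i))
      pt-adj : ∀ i → T (adj (pt true i) (pt false i))
      cover  : ∀ z → T (P z) → ∃₂ (λ x i → pt x i ≡ z)
      edges  : ∀ u v → T (P u) → T (P v) → T (adj u v) →
               ∃ (λ i → (u ≡ pt true i × v ≡ pt false i) ⊎ (u ≡ pt false i × v ≡ pt true i))

  Edge : Set
  Edge = Fin n × Fin n

  _≈E_ : Edge → Edge → Set
  (a , b) ≈E (c , d) = (a ≡ c × b ≡ d) ⊎ (a ≡ d × b ≡ c)

  EdgeSub : (Fin n → Bool) → Edge → Set
  EdgeSub P (a , b) = T (P a) × T (P b)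

  EdgeIn : (Fin n → Bool) → Edge → Set
  EdgeIn P (a , b) = T (P a) × T (P b) × T (adj a b)

  -- α, β, γ, δ are the edges of a 4-cycle v0 v1 v2 v3, with α, β opposite
  -- (α = v0v1, γ = v1v2, β = v2v3, δ = v3v0)
  Square : Edge → Edge → Edge → Edge → Set
  Square α β γ δ = Σ (Fin n) λ v0 → Σ (Fin n) λ v1 → Σ (Fin n) λ v2 → Σ (Fin n) λ v3 →
      (v0 ≢ v1 × v0 ≢ v2 × v0 ≢ v3 × v1 ≢ v2 × v1 ≢ v3 × v2 ≢ v3)
    × (T (adj v0 v1) × T (adj v1 v2) × T (adj v2 v3) × T (adj v3 v0))
    × (α ≈E (v0 , v1) × γ ≈E (v1 , v2) × β ≈E (v2 , v3) × δ ≈E (v3 , v0))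

  module _ (y : Fin n) {s : ℕ} (E : EdgePartition (dist1 y) s) where
    open EdgePartition E

    -- A x i : A'_i for x = true, A''_i for x = false
    A : Bool → Fin s → Fin n → Bool
    A x i z = dist2 y z ∧ adj (pt x i) z

    Split : Fin s → Edge → Edge → Set
    Split j b c = (EdgeSub (A true j) b × EdgeSub (A false j) c)
                ⊎ (EdgeSub (A false j) b × EdgeSub (A true j) c)

    Part2 : ℕ → Set
    Part2 s̄ = ∀ i → (∀ z → T (dist2 y z) →
                        (T (A true i z) ⊎ T (A false i z)) × ¬ (T (A true i z) × T (A false i z)))
                  × count (A true i) ≡ s̄ × count (A false i) ≡ s̄

    Part3 : Set
    Part3 = ∀ u v w → T (dist2 y u) → T (dist2 y v) → T (dist2 y w) →
            T (adj u v) → T (adj v w) → T (adj u w) → ⊥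

    Part4 : Set
    Part4 = (∀ u v → EdgeIn (dist2 y) (u , v) →
               Σ Bool λ x → Σ (Fin s) λ i → EdgeSub (A x i) (u , v)
                 × (∀ x' i' → EdgeSub (A x' i') (u , v) → x' ≡ x × i' ≡ i))
          × (∀ x i → EdgePartition (A x i) (s ∸ 1))

    Part5 : Set
    Part5 = ∀ i (α' α'' : Edge) → EdgeIn (A true i) α' → EdgeIn (A false i) α'' →
      Σ Edge λ β' → Σ Edge λ β'' →
          (EdgeIn (dist2 y) β' × EdgeIn (dist2 y) β'' × Square α' α'' β' β'')
        × (∀ γ' γ'' → EdgeIn (dist2 y) γ' → EdgeIn (dist2 y) γ'' → Square α' α'' γ' γ'' →
             (γ' ≈E β' × γ'' ≈E β'') ⊎ (γ' ≈E β'' × γ'' ≈E β'))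
        × Σ (Fin s) (λ j → Split j β' β'' × (∀ j' → Split j' β' β'' → j' ≡ j))

module Submission where

-- With t = 1 every edge lies in exactly one triangle, so adjacent vertices have a unique common
-- neighbour. Hence a point of Λ(y,1) has exactly one neighbour in Λ(y,1), and a point z of A'_i
-- exactly one in A'_i (the apex of the triangle on a'_i z lies in Λ(y,2)); a set of even size
-- carrying such a perfect matching is a union of disjoint edges. A'_i and A''_i are disjoint since y
-- is the only common neighbour of a'_i and a''_i, so by cardinality they partition Λ(y,2). Double
-- counting the edges between the neighbours of a point of Λ(y,2) in Λ(y,1) and in Λ(y,2) shows that
-- every edge of Λ_2 has a common neighbour in Λ(y,1), which places it in exactly one set A'_j, A''_j;
-- a triangle of Λ_2 has two vertices on one side of {A'_i, A''_i}, and their unique common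
-- neighbour in Λ(y,1) cannot be the third vertex. A second double counting inside A''_i shows that
-- a point of A'_i sees exactly one end of every edge of A''_i, which closes the squares of (5).

open import Defs
open import Data.Bool using (Bool; true; false; T; _∧_; not; if_then_else_)
open import Data.Bool.Properties using (∧-comm; ∧-assoc)
open import Data.Empty using (⊥-elim)
open import Data.Fin using (Fin; zero; suc; _≟_)
import Data.Fin.Properties as Fin
open import Data.Nat using (ℕ; zero; suc; _+_; _*_; _∸_; _≤_; z≤n)
open import Data.Nat.Properties hiding (_≟_)
open import Algebra.Properties.CommutativeMonoid.Sum +-0-commutativeMonoid using (sum; ∑-comm; sum-cong-≗)
open import Data.Product using (Σ; ∃; ∃₂; _×_; _,_; proj₁; proj₂; map₂)
open import Data.Sum using (_⊎_; inj₁; inj₂; swap)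
open import Data.Unit using (tt)
open import Function using (_∘_)
open import Relation.Binary.PropositionalEquality
  using (_≡_; _≢_; refl; sym; trans; cong; cong₂; subst; subst₂; ≢-sym; module ≡-Reasoning)
open import Relation.Nullary using (¬_; yes; no)
open import Relation.Nullary.Decidable using (⌊_⌋; T?)

∧⁺ : ∀ {a b} → T a → T b → T (a ∧ b)
∧⁺ {true} {true} _ _ = tt

∧⁻ˡ : ∀ {a b} → T (a ∧ b) → T a
∧⁻ˡ {true} _ = tt

∧⁻ʳ : ∀ {a b} → T (a ∧ b) → T b
∧⁻ʳ {true} {true} _ = tt

not⁺ : ∀ {a} → ¬ T a → T (not a)
not⁺ {true} ¬a = ¬a tt
not⁺ {false} _ = tt

not⁻ : ∀ {a} → T (not a) → ¬ T a
not⁻ {true} ()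

≢⇒T-not-≟ : ∀ {n} {i j : Fin n} → i ≢ j → T (not ⌊ i ≟ j ⌋)
≢⇒T-not-≟ {i = i} {j} i≢j with i ≟ j
... | yes i≡j = i≢j i≡j
... | no _ = tt

T-not-≟⇒≢ : ∀ {n} {i j : Fin n} → T (not ⌊ i ≟ j ⌋) → i ≢ j
T-not-≟⇒≢ {i = i} {j} t with i ≟ j
T-not-≟⇒≢ () | yes _
... | no i≢j = i≢j

T-≟⇒≡ : ∀ {n} {i j : Fin n} → T ⌊ i ≟ j ⌋ → i ≡ j
T-≟⇒≡ {i = i} {j} t with i ≟ j
... | yes i≡j = i≡j

≡⇒T-≟ : ∀ {n} {i j : Fin n} → i ≡ j → T ⌊ i ≟ j ⌋
≡⇒T-≟ {i = i} {j} i≡j with i ≟ j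
... | yes _ = tt
... | no i≢j = i≢j i≡j

indicator : Bool → ℕ
indicator b = if b then 1 else 0

indicator-T : ∀ {b} → T b → indicator b ≡ 1
indicator-T {true} _ = refl

indicator-¬T : ∀ {b} → ¬ T b → indicator b ≡ 0
indicator-¬T {true} ¬b = ⊥-elim (¬b tt)
indicator-¬T {false} _ = refl

count≡sum : ∀ {n} (p : Fin n → Bool) → count p ≡ sum (indicator ∘ p)
count≡sum {zero} p = refl
count≡sum {suc n} p = cong (indicator (p zero) +_) (count≡sum (p ∘ suc))

sum-mono-≤ : ∀ {n} {f g : Fin n → ℕ} → (∀ i → f i ≤ g i) → sum f ≤ sum g
sum-mono-≤ {zero} f≤g = z≤n
sum-mono-≤ {suc n} f≤g = +-mono-≤ (f≤g zero) (sum-mono-≤ (f≤g ∘ suc))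

sum-≤-≡⇒≡ : ∀ {n} {f g : Fin n → ℕ} → (∀ i → f i ≤ g i) → sum f ≡ sum g → ∀ i → f i ≡ g i
sum-≤-≡⇒≡ {suc n} {f} {g} f≤g Σf≡Σg = go
  where
  head≡ : f zero ≡ g zero
  head≡ with m≤n⇒m<n∨m≡n (f≤g zero)
  ... | inj₂ eq = eq
  ... | inj₁ lt = ⊥-elim (<⇒≢ (+-mono-<-≤ lt (sum-mono-≤ (f≤g ∘ suc))) Σf≡Σg)
  go : ∀ i → f i ≡ g i
  go zero = head≡
  go (suc i) = sum-≤-≡⇒≡ (f≤g ∘ suc) (+-cancelˡ-≡ (g zero) _ _ (subst (λ x → x + _ ≡ _) head≡ Σf≡Σg)) i

count-cong : ∀ {n} {p q : Fin n → Bool} → (∀ i → p i ≡ q i) → count p ≡ count q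
count-cong {zero} p≗q = refl
count-cong {suc n} p≗q = cong₂ _+_ (cong indicator (p≗q zero)) (count-cong (p≗q ∘ suc))

count-ext : ∀ {n} {p q : Fin n → Bool} →
  (∀ i → T (p i) → T (q i)) → (∀ i → T (q i) → T (p i)) → count p ≡ count q
count-ext p⇒q q⇒p = count-cong (λ i → ⇔⇒≡ (p⇒q i) (q⇒p i))
  where
  ⇔⇒≡ : ∀ {a b} → (T a → T b) → (T b → T a) → a ≡ b
  ⇔⇒≡ {true} {true} _ _ = refl
  ⇔⇒≡ {true} {false} a⇒b _ = ⊥-elim (a⇒b tt)
  ⇔⇒≡ {false} {true} _ b⇒a = ⊥-elim (b⇒a tt)
  ⇔⇒≡ {false} {false} _ _ = refl

count-mono : ∀ {n} {p q : Fin n → Bool} → (∀ i → T (p i) → T (q i)) → count p ≤ count q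
count-mono {zero} p⇒q = z≤n
count-mono {suc n} {p} {q} p⇒q = +-mono-≤ (head-≤ (p zero) (q zero) (p⇒q zero)) (count-mono (p⇒q ∘ suc))
  where
  head-≤ : ∀ a b → (T a → T b) → indicator a ≤ indicator b
  head-≤ true true _ = ≤-refl
  head-≤ true false a⇒b = ⊥-elim (a⇒b tt)
  head-≤ false _ _ = z≤n

count≡0 : ∀ {n} {p : Fin n → Bool} → (∀ i → ¬ T (p i)) → count p ≡ 0
count≡0 {zero} _ = refl
count≡0 {suc n} ¬p = cong₂ _+_ (indicator-¬T (¬p zero)) (count≡0 (¬p ∘ suc))

count≡0⇒¬T : ∀ {n} {p : Fin n → Bool} → count p ≡ 0 → ∀ i → ¬ T (p i)
count≡0⇒¬T {suc n} {p} c≡0 i pi with p zero in eq | i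
count≡0⇒¬T {suc n} {p} () i pi | true | _
... | false | zero = subst T eq pi
... | false | suc i′ = count≡0⇒¬T c≡0 i′ pi

count≡suc⇒∃ : ∀ {n} {p : Fin n → Bool} {k} → count p ≡ suc k → ∃ λ i → T (p i)
count≡suc⇒∃ {suc n} {p} c with p zero in eq
... | true = zero , subst T (sym eq) tt
... | false = let (i , pi) = count≡suc⇒∃ c in suc i , pi

count-split : ∀ {n} (p q : Fin n → Bool) →
  count p ≡ count (λ z → p z ∧ q z) + count (λ z → p z ∧ not (q z))
count-split {zero} p q = refl
count-split {suc n} p q with p zero | q zero
... | true | true = cong suc (count-split (p ∘ suc) (q ∘ suc))
... | true | false = trans (cong suc (count-split (p ∘ suc) (q ∘ suc))) (sym (+-suc _ _))
... | false | _ = count-split (p ∘ suc) (q ∘ suc)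

count≡1 : ∀ {n} {p : Fin n → Bool} (a : Fin n) → T (p a) → (∀ z → T (p z) → z ≡ a) → count p ≡ 1
count≡1 {suc n} {p} zero pa unique with p zero
... | true = cong suc (count≡0 (λ i pi → Fin.0≢1+n (sym (unique (suc i) pi))))
count≡1 {suc n} {p} (suc a) pa unique with p zero in eq
... | true = ⊥-elim (Fin.0≢1+n (unique zero (subst T (sym eq) tt)))
... | false = count≡1 a pa (λ z pz → Fin.suc-injective (unique (suc z) pz))

count-remove : ∀ {n} {p : Fin n → Bool} (a : Fin n) → T (p a) →
  count p ≡ suc (count (λ z → p z ∧ not ⌊ z ≟ a ⌋))
count-remove {p = p} a pa = trans (count-split p (λ z → ⌊ z ≟ a ⌋))
  (cong (_+ count (λ z → p z ∧ not ⌊ z ≟ a ⌋)) (count≡1 a (∧⁺ pa (≡⇒T-≟ refl)) (λ z t → T-≟⇒≡ (∧⁻ʳ {p z} t))))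

count≡1⇒unique : ∀ {n} {p : Fin n → Bool} → count p ≡ 1 → ∀ {a b} → T (p a) → T (p b) → a ≡ b
count≡1⇒unique {p = p} c≡1 {a} {b} pa pb with a ≟ b
... | yes a≡b = a≡b
... | no a≢b = ⊥-elim (count≡0⇒¬T (suc-injective (trans (sym (count-remove b pb)) c≡1)) a
                  (∧⁺ pa (≢⇒T-not-≟ a≢b)))

count-⊆-≡⇒⊇ : ∀ {n} {p q : Fin n → Bool} → (∀ i → T (p i) → T (q i)) → count p ≡ count q →
  ∀ i → T (q i) → T (p i)
count-⊆-≡⇒⊇ {p = p} {q} p⊆q cp≡cq i qi with T? (p i)
... | yes pi = pi
... | no ¬pi = ⊥-elim (count≡0⇒¬T rest≡0 i (∧⁺ qi (not⁺ ¬pi)))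
  where
  rest≡0 : count (λ z → q z ∧ not (p z)) ≡ 0
  rest≡0 = +-cancelˡ-≡ (count p) _ 0 (begin
    count p + count (λ z → q z ∧ not (p z))
      ≡⟨ cong (_+ count (λ z → q z ∧ not (p z))) (count-ext (λ z pz → ∧⁺ (p⊆q z pz) pz) (λ z t → ∧⁻ʳ {q z} t)) ⟩
    count (λ z → q z ∧ p z) + count (λ z → q z ∧ not (p z))  ≡⟨ count-split q p ⟨
    count q                                                  ≡⟨ cp≡cq ⟨
    count p                                                  ≡⟨ +-identityʳ _ ⟨
    count p + 0                                              ∎)
    where open ≡-Reasoning

double-counting : ∀ {m n} (Q : Fin m → Bool) (R : Fin n → Bool) (M : Fin m → Fin n → Bool) →
  (∀ w → count (λ z → M z w) ≡ indicator (R w)) → (∀ z → count (M z) ≤ indicator (Q z)) →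
  count R ≡ count Q → ∀ z → T (Q z) → count (M z) ≡ 1
double-counting Q R M columns rows |R|≡|Q| z Qz =
  trans (sum-≤-≡⇒≡ rows total z) (indicator-T Qz)
  where
  open ≡-Reasoning
  total : sum (λ z → count (M z)) ≡ sum (indicator ∘ Q)
  total = begin
    sum (λ z → count (M z))                     ≡⟨ sum-cong-≗ (λ z → count≡sum (M z)) ⟩
    sum (λ z → sum (λ w → indicator (M z w)))   ≡⟨ ∑-comm (λ z w → indicator (M z w)) ⟩
    sum (λ w → sum (λ z → indicator (M z w)))   ≡⟨ sum-cong-≗ (λ w → sym (count≡sum (λ z → M z w))) ⟩
    sum (λ w → count (λ z → M z w))             ≡⟨ sum-cong-≗ columns ⟩
    sum (indicator ∘ R)                         ≡⟨ count≡sum R ⟨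
    count R                                     ≡⟨ |R|≡|Q| ⟩
    count Q                                     ≡⟨ count≡sum Q ⟩
    sum (indicator ∘ Q)                         ∎

module _ {n : ℕ} (G : SimpleGraph n) where
  open SimpleGraph G renaming (sym to adj-comm)

  adj-sym : ∀ {u v} → T (adj u v) → T (adj v u)
  adj-sym {u} {v} = subst T (adj-comm u v)

  adj⇒≢ : ∀ {u v} → T (adj u v) → u ≢ v
  adj⇒≢ {u} uv refl = subst T (irrefl u) uv

  dist2⇒≢ : ∀ {y z} → T (dist2 G y z) → y ≢ z
  dist2⇒≢ d = T-not-≟⇒≢ (∧⁻ˡ d)

  dist2⇒¬adj : ∀ {y z} → T (dist2 G y z) → ¬ T (adj y z)
  dist2⇒¬adj {y} {z} d = not⁻ (∧⁻ˡ (∧⁻ʳ {not ⌊ y ≟ z ⌋} d))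

  double-counting-neighbours : ∀ {Q R : Fin n → Bool} →
    (∀ w → T (R w) → count (λ z → Q z ∧ adj w z) ≡ 1) →
    (∀ z → T (Q z) → count (λ w → R w ∧ adj z w) ≤ 1) →
    count R ≡ count Q → ∀ z → T (Q z) → ∃ λ w → T (R w) × T (adj z w)
  double-counting-neighbours {Q} {R} R→Q Q→R |R|≡|Q| z Qz
    with count≡suc⇒∃ {p = M z} (double-counting Q R M columns rows |R|≡|Q| z Qz)
    where
    M : Fin n → Fin n → Bool
    M z w = Q z ∧ (R w ∧ adj z w)
    columns : ∀ w → count (λ z → M z w) ≡ indicator (R w)
    columns w with T? (R w)
    ... | yes Rw = trans (count-ext {q = λ z → Q z ∧ adj w z}
                           (λ z t → ∧⁺ (∧⁻ˡ {Q z} t) (adj-sym (∧⁻ʳ {R w} (∧⁻ʳ {Q z} t))))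
                           (λ z t → ∧⁺ (∧⁻ˡ {Q z} t) (∧⁺ Rw (adj-sym (∧⁻ʳ {Q z} t)))))
                         (trans (R→Q w Rw) (sym (indicator-T Rw)))
    ... | no ¬Rw = trans (count≡0 (λ z t → ¬Rw (∧⁻ˡ (∧⁻ʳ {Q z} t)))) (sym (indicator-¬T ¬Rw))
    rows : ∀ z → count (M z) ≤ indicator (Q z)
    rows z with T? (Q z)
    ... | yes Qz = ≤-trans (count-mono {p = M z} (λ w t → ∧⁻ʳ {Q z} t))
                           (≤-trans (Q→R z Qz) (≤-reflexive (sym (indicator-T Qz))))
    ... | no ¬Qz = ≤-reflexive (trans (count≡0 {p = M z} (λ w t → ¬Qz (∧⁻ˡ {Q z} t))) (sym (indicator-¬T ¬Qz)))
  ... | w , t = w , ∧⁻ˡ (∧⁻ʳ {Q z} t) , ∧⁻ʳ {R w} (∧⁻ʳ {Q z} t)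

  ≈E-refl : ∀ {α} → _≈E_ G α α
  ≈E-refl = inj₁ (refl , refl)

  ≈E-sym : ∀ {α β} → _≈E_ G α β → _≈E_ G β α
  ≈E-sym (inj₁ (refl , refl)) = inj₁ (refl , refl)
  ≈E-sym (inj₂ (refl , refl)) = inj₂ (refl , refl)

  ≈E-trans : ∀ {α β γ} → _≈E_ G α β → _≈E_ G β γ → _≈E_ G α γ
  ≈E-trans (inj₁ (refl , refl)) βγ = βγ
  ≈E-trans (inj₂ (refl , refl)) (inj₁ (refl , refl)) = inj₂ (refl , refl)
  ≈E-trans (inj₂ (refl , refl)) (inj₂ (refl , refl)) = inj₁ (refl , refl)

  ≈E-flip : ∀ {α u v} → _≈E_ G α (u , v) → _≈E_ G α (v , u)
  ≈E-flip (inj₁ e) = inj₂ e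
  ≈E-flip (inj₂ e) = inj₁ e

  InducesPerfectMatching : (Fin n → Bool) → Set
  InducesPerfectMatching P = ∀ z → T (P z) → count (λ w → adj z w ∧ P w) ≡ 1

  module _ {P : Fin n → Bool} (matching : InducesPerfectMatching P) where

    partner-unique : ∀ {z w w′} → T (P z) → T (adj z w ∧ P w) → T (adj z w′ ∧ P w′) → w ≡ w′
    partner-unique Pz = count≡1⇒unique (matching _ Pz)

    module RemoveEdge {a b : Fin n} (Pa : T (P a)) (ab∧Pb : T (adj a b ∧ P b)) where

      ab : T (adj a b)
      ab = ∧⁻ˡ ab∧Pb

      Pb : T (P b)
      Pb = ∧⁻ʳ {adj a b} ab∧Pb

      P′ : Fin n → Bool
      P′ z = P z ∧ (not ⌊ z ≟ a ⌋ ∧ not ⌊ z ≟ b ⌋)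

      count-P′ : count P ≡ 2 + count P′
      count-P′ = begin
        count P                                                   ≡⟨ count-remove a Pa ⟩
        suc (count (λ z → P z ∧ not ⌊ z ≟ a ⌋))                   ≡⟨ cong suc (count-remove b Pb∖a) ⟩
        2 + count (λ z → (P z ∧ not ⌊ z ≟ a ⌋) ∧ not ⌊ z ≟ b ⌋)
          ≡⟨ cong (2 +_) (count-cong (λ z → ∧-assoc (P z) _ _)) ⟩
        2 + count P′                                              ∎
        where
        open ≡-Reasoning
        Pb∖a : T (P b ∧ not ⌊ b ≟ a ⌋)
        Pb∖a = ∧⁺ Pb (≢⇒T-not-≟ (≢-sym (adj⇒≢ ab)))

      matching′ : InducesPerfectMatching P′
      matching′ z P′z with count≡suc⇒∃ (matching z (∧⁻ˡ P′z))
      ... | c , zc∧Pc = count≡1 c (∧⁺ zc (∧⁺ Pc (∧⁺ (≢⇒T-not-≟ c≢a) (≢⇒T-not-≟ c≢b))))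
                          (λ w t → partner-unique Pz (∧⁺ (∧⁻ˡ {adj z w} t) (∧⁻ˡ {P w} (∧⁻ʳ {adj z w} t))) zc∧Pc)
        where
        Pz = ∧⁻ˡ P′z
        z≢a = T-not-≟⇒≢ (∧⁻ˡ (∧⁻ʳ {P z} P′z))
        z≢b = T-not-≟⇒≢ (∧⁻ʳ {not ⌊ z ≟ a ⌋} (∧⁻ʳ {P z} P′z))
        zc = ∧⁻ˡ zc∧Pc
        Pc = ∧⁻ʳ {adj z c} zc∧Pc
        c≢a : c ≢ a
        c≢a refl = z≢b (partner-unique Pa (∧⁺ (adj-sym zc) Pz) ab∧Pb)
        c≢b : c ≢ b
        c≢b refl = z≢a (partner-unique Pb (∧⁺ (adj-sym zc) Pz) (∧⁺ (adj-sym ab) Pa))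

      extend : ∀ {k} → EdgePartition G P′ k → EdgePartition G P (suc k)
      extend {k} R = record
        { pt = pt ; pt-inj = pt-inj ; pt-in = pt-in ; pt-adj = pt-adj ; cover = cover ; edges = edges }
        where
        module R = EdgePartition R

        endpoint : Bool → Fin n
        endpoint true = a
        endpoint false = b

        pt : Bool → Fin (suc k) → Fin n
        pt x zero = endpoint x
        pt x (suc i) = R.pt x i

        endpoint-injective : ∀ x x′ → endpoint x ≡ endpoint x′ → x ≡ x′
        endpoint-injective true true _ = refl
        endpoint-injective true false a≡b = ⊥-elim (adj⇒≢ ab a≡b)
        endpoint-injective false true b≡a = ⊥-elim (adj⇒≢ ab (sym b≡a))
        endpoint-injective false false _ = refl

        endpoint∉P′ : ∀ x x′ i → endpoint x ≢ R.pt x′ i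
        endpoint∉P′ true x′ i e = T-not-≟⇒≢ (∧⁻ˡ (∧⁻ʳ {P (R.pt x′ i)} (R.pt-in x′ i))) (sym e)
        endpoint∉P′ false x′ i e =
          T-not-≟⇒≢ (∧⁻ʳ {not ⌊ R.pt x′ i ≟ a ⌋} (∧⁻ʳ {P (R.pt x′ i)} (R.pt-in x′ i))) (sym e)

        pt-inj : ∀ x i x′ i′ → pt x i ≡ pt x′ i′ → x ≡ x′ × i ≡ i′
        pt-inj x zero x′ zero e = endpoint-injective x x′ e , refl
        pt-inj x zero x′ (suc i′) e = ⊥-elim (endpoint∉P′ x x′ i′ e)
        pt-inj x (suc i) x′ zero e = ⊥-elim (endpoint∉P′ x′ x i (sym e))
        pt-inj x (suc i) x′ (suc i′) e = map₂ (cong suc) (R.pt-inj x i x′ i′ e)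

        pt-in : ∀ x i → T (P (pt x i))
        pt-in true zero = Pa
        pt-in false zero = Pb
        pt-in x (suc i) = ∧⁻ˡ (R.pt-in x i)

        pt-adj : ∀ i → T (adj (pt true i) (pt false i))
        pt-adj zero = ab
        pt-adj (suc i) = R.pt-adj i

        in-P′ : ∀ {z} → T (P z) → z ≢ a → z ≢ b → T (P′ z)
        in-P′ Pz z≢a z≢b = ∧⁺ Pz (∧⁺ (≢⇒T-not-≟ z≢a) (≢⇒T-not-≟ z≢b))

        cover : ∀ z → T (P z) → ∃₂ (λ x i → pt x i ≡ z)
        cover z Pz with z ≟ a | z ≟ b
        ... | yes refl | _ = true , zero , refl
        ... | no _ | yes refl = false , zero , refl
        ... | no z≢a | no z≢b with R.cover z (in-P′ Pz z≢a z≢b)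
        ... | x , i , e = x , suc i , e

        edges : ∀ u v → T (P u) → T (P v) → T (adj u v) →
          ∃ (λ i → (u ≡ pt true i × v ≡ pt false i) ⊎ (u ≡ pt false i × v ≡ pt true i))
        edges u v Pu Pv uv with u ≟ a | u ≟ b
        ... | yes refl | _ = zero , inj₁ (refl , partner-unique Pa (∧⁺ uv Pv) ab∧Pb)
        ... | no _ | yes refl = zero , inj₂ (refl , partner-unique Pb (∧⁺ uv Pv) (∧⁺ (adj-sym ab) Pa))
        ... | no u≢a | no u≢b with v ≟ a | v ≟ b
        ... | yes refl | _ = ⊥-elim (u≢b (partner-unique Pa (∧⁺ (adj-sym uv) Pu) ab∧Pb))
        ... | no _ | yes refl = ⊥-elim (u≢a (partner-unique Pb (∧⁺ (adj-sym uv) Pu) (∧⁺ (adj-sym ab) Pa)))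
        ... | no v≢a | no v≢b with R.edges u v (in-P′ Pu u≢a u≢b) (in-P′ Pv v≢a v≢b) uv
        ... | i , e = suc i , e

  perfectMatching⇒EdgePartition : ∀ m {P : Fin n → Bool} → count P ≡ 2 * m →
    InducesPerfectMatching P → EdgePartition G P m
  perfectMatching⇒EdgePartition zero |P|≡0 _ = record
    { pt = λ _ () ; pt-inj = λ _ () ; pt-in = λ _ () ; pt-adj = λ ()
    ; cover = λ z Pz → ⊥-elim (count≡0⇒¬T |P|≡0 z Pz)
    ; edges = λ u _ Pu → ⊥-elim (count≡0⇒¬T |P|≡0 u Pu) }
  perfectMatching⇒EdgePartition (suc m) {P} |P|≡2+2m matching
    with count≡suc⇒∃ {p = P} |P|≡2+2m
  ... | a , Pa with count≡suc⇒∃ {p = λ w → adj a w ∧ P w} (matching a Pa)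
  ... | b , ab∧Pb = extend (perfectMatching⇒EdgePartition m |P′|≡2m matching′)
    where
    open RemoveEdge matching Pa ab∧Pb
    |P′|≡2m : count P′ ≡ 2 * m
    |P′|≡2m = +-cancelˡ-≡ 2 _ _ (trans (sym count-P′) (trans |P|≡2+2m (*-distribˡ-+ 2 1 m)))

1+x+1≡2*s⇒s≡1+[s∸1] : ∀ x s → 1 + x + 1 ≡ 2 * s → s ≡ suc (s ∸ 1)
1+x+1≡2*s⇒s≡1+[s∸1] x zero ()
1+x+1≡2*s⇒s≡1+[s∸1] x (suc s) _ = refl

1+x+1≡2*s⇒x≡2*[s∸1] : ∀ x s → 1 + x + 1 ≡ 2 * s → x ≡ 2 * (s ∸ 1)
1+x+1≡2*s⇒x≡2*[s∸1] x zero ()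
1+x+1≡2*s⇒x≡2*[s∸1] x (suc s) eq =
  suc-injective (trans (+-comm 1 x) (trans (suc-injective eq) (+-suc s (s + 0))))

module Extensible {n : ℕ} (G : SimpleGraph n) {s s̄ : ℕ} (ext : IsExtensible G 1 s s̄) where
  open SimpleGraph G using (adj)
  open IsExtensible ext

  s≡1+[s∸1] : s ≡ suc (s ∸ 1)
  s≡1+[s∸1] = 1+x+1≡2*s⇒s≡1+[s∸1] s̄ s t-def

  s̄≡2*[s∸1] : s̄ ≡ 2 * (s ∸ 1)
  s̄≡2*[s∸1] = 1+x+1≡2*s⇒x≡2*[s∸1] s̄ s t-def

  common-neighbour-unique : ∀ {u v a b} → T (adj u v) →
    T (adj a u) → T (adj a v) → T (adj b u) → T (adj b v) → a ≡ b
  common-neighbour-unique {u} {v} uv au av bu bv =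
    count≡1⇒unique (triangles u v uv) (∧⁺ (adj-sym G au) (adj-sym G av)) (∧⁺ (adj-sym G bu) (adj-sym G bv))

  dist1-partition : ∀ y → EdgePartition G (dist1 G y) s
  dist1-partition y = perfectMatching⇒EdgePartition G s (card1 y) (nbr1-1 y)

  -- A G y E x i is outerNeighbours y (pt x i) by definition.
  outerNeighbours : Fin n → Fin n → Fin n → Bool
  outerNeighbours y x w = dist2 G y w ∧ adj x w

  module _ {y x : Fin n} (yx : T (dist1 G y x)) where

    common-neighbour-dist2 : ∀ {z w} → T (dist2 G y z) → T (adj x z) → T (adj x w) → T (adj z w) →
      T (dist2 G y w)
    common-neighbour-dist2 {z} {w} yz xz xw zw with proj₁ diam y w
    ... | inj₁ refl = ⊥-elim (dist2⇒¬adj G yz (adj-sym G zw))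
    ... | inj₂ (inj₁ yw) = ⊥-elim (dist2⇒≢ G yz (common-neighbour-unique xw yx yw (adj-sym G xz) zw))
    ... | inj₂ (inj₂ yw) = yw

    count-outerNeighbours : count (outerNeighbours y x) ≡ s̄
    count-outerNeighbours = trans (count-cong (λ w → ∧-comm (dist2 G y w) _)) (nbr1-2 y x yx)

    outerNeighbours-matching : InducesPerfectMatching G (outerNeighbours y x)
    outerNeighbours-matching z x∼z = trans
      (count-ext {q = λ w → adj x w ∧ adj z w}
        (λ w t → ∧⁺ (∧⁻ʳ {dist2 G y w} (∧⁻ʳ {adj z w} t)) (∧⁻ˡ t))
        (λ w t → let xw = ∧⁻ˡ {adj x w} t ; zw = ∧⁻ʳ {adj x w} t in
                   ∧⁺ zw (∧⁺ (common-neighbour-dist2 yz xz xw zw) xw)))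
      (triangles x z xz)
      where
      yz = ∧⁻ˡ x∼z
      xz = ∧⁻ʳ {dist2 G y z} x∼z

    outerNeighbours-partition : EdgePartition G (outerNeighbours y x) (s ∸ 1)
    outerNeighbours-partition = perfectMatching⇒EdgePartition G (s ∸ 1)
      (trans count-outerNeighbours s̄≡2*[s∸1]) outerNeighbours-matching

  -- z has s neighbours in Λ(y,1) and s in Λ(y,2); each of the former is adjacent to exactly one of
  -- the latter (the apex of their triangle) and each of the latter to at most one of the former.
  dist2-edge-has-common-dist1-neighbour : ∀ {y z w} → T (dist2 G y z) → T (dist2 G y w) → T (adj z w) →
    ∃ λ x → T (dist1 G y x) × T (adj x z) × T (adj x w)
  dist2-edge-has-common-dist1-neighbour {y} {z} {w} yz yw zw
    with double-counting-neighbours G {Q = outerNeighbours y z} {R = R} R→Q Q→R |R|≡|Q| w (∧⁺ yw zw)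
    where
    R : Fin n → Bool
    R x = dist1 G y x ∧ adj z x
    R→Q : ∀ x → T (R x) → count (λ w → outerNeighbours y z w ∧ adj x w) ≡ 1
    R→Q x Rx = trans
      (count-ext {q = λ w → adj x w ∧ adj z w}
        (λ w t → ∧⁺ (∧⁻ʳ {outerNeighbours y z w} t) (∧⁻ʳ {dist2 G y w} (∧⁻ˡ t)))
        (λ w t → let xw = ∧⁻ˡ {adj x w} t ; zw = ∧⁻ʳ {adj x w} t in
                   ∧⁺ (∧⁺ (common-neighbour-dist2 yx yz (adj-sym G zx) xw zw) zw) xw))
      (triangles x z (adj-sym G zx))
      where
      yx = ∧⁻ˡ Rx
      zx = ∧⁻ʳ {dist1 G y x} Rx
    Q→R : ∀ w → T (outerNeighbours y z w) → count (λ x → R x ∧ adj w x) ≤ 1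
    Q→R w Qw = ≤-trans
      (count-mono {q = λ x → adj z x ∧ adj w x} (λ x t → ∧⁺ (∧⁻ʳ {dist1 G y x} (∧⁻ˡ t)) (∧⁻ʳ {R x} t)))
      (≤-reflexive (triangles z w (∧⁻ʳ {dist2 G y w} Qw)))
    |R|≡|Q| : count R ≡ count (outerNeighbours y z)
    |R|≡|Q| = begin
      count R                                   ≡⟨ count-cong (λ x → ∧-comm (dist1 G y x) _) ⟩
      count (λ x → adj z x ∧ dist1 G y x)       ≡⟨ nbr2-1 y z yz ⟩
      s                                         ≡⟨ nbr2-2 y z yz ⟨
      count (λ w → adj z w ∧ dist2 G y w)       ≡⟨ count-cong (λ w → ∧-comm (adj z w) _) ⟩
      count (outerNeighbours y z)               ∎
      where open ≡-Reasoning
  ... | x , Rx , wx = x , ∧⁻ˡ Rx , adj-sym G (∧⁻ʳ {dist1 G y x} Rx) , adj-sym G wx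

  module Layers (y : Fin n) (E : EdgePartition G (dist1 G y) s) where
    open EdgePartition E

    A⇒dist2 : ∀ {x i z} → T (A G y E x i z) → T (dist2 G y z)
    A⇒dist2 {x} {i} {z} = ∧⁻ˡ {dist2 G y z} {adj (pt x i) z}

    A⇒adj : ∀ {x i z} → T (A G y E x i z) → T (adj (pt x i) z)
    A⇒adj {x} {i} {z} = ∧⁻ʳ {dist2 G y z}

    count-A : ∀ x i → count (A G y E x i) ≡ s̄
    count-A x i = count-outerNeighbours (pt-in x i)

    A-disjoint : ∀ i z → T (A G y E true i z) → ¬ T (A G y E false i z)
    A-disjoint i z A′z A″z = dist2⇒≢ G (A⇒dist2 A′z)
      (common-neighbour-unique (pt-adj i) (pt-in true i) (pt-in false i)
        (adj-sym G (A⇒adj A′z)) (adj-sym G (A⇒adj A″z)))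

    A-cover : ∀ i z → T (dist2 G y z) → T (A G y E true i z) ⊎ T (A G y E false i z)
    A-cover i z yz with T? (adj (pt true i) z)
    ... | yes a′z = inj₁ (∧⁺ yz a′z)
    ... | no ¬a′z = inj₂ (count-⊆-≡⇒⊇ {p = A G y E false i} {q = Y₂∖A′}
                           (λ w A″w → ∧⁺ (A⇒dist2 A″w) (not⁺ (λ a′w → A-disjoint i w (∧⁺ (A⇒dist2 A″w) a′w) A″w)))
                           (trans (count-A false i) (sym |Y₂∖A′|≡s̄)) z (∧⁺ yz (not⁺ ¬a′z)))
      where
      Y₂∖A′ : Fin n → Bool
      Y₂∖A′ w = dist2 G y w ∧ not (adj (pt true i) w)
      |Y₂∖A′|≡s̄ : count Y₂∖A′ ≡ s̄
      |Y₂∖A′|≡s̄ = +-cancelˡ-≡ s̄ _ _ (begin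
        s̄ + count Y₂∖A′                      ≡⟨ cong (_+ count Y₂∖A′) (count-A true i) ⟨
        count (A G y E true i) + count Y₂∖A′  ≡⟨ count-split (dist2 G y) (adj (pt true i)) ⟨
        count (dist2 G y)                     ≡⟨ card2 y ⟩
        2 * s̄                                 ≡⟨ cong (s̄ +_) (+-identityʳ s̄) ⟩
        s̄ + s̄                                 ∎)
        where open ≡-Reasoning

    ¬A′⇒A″ : ∀ {i z} → T (dist2 G y z) → ¬ T (A G y E true i z) → T (A G y E false i z)
    ¬A′⇒A″ {i} {z} yz ¬A′z with A-cover i z yz
    ... | inj₁ A′z = ⊥-elim (¬A′z A′z)
    ... | inj₂ A″z = A″z

    A-cover′ : ∀ j z b → T (dist2 G y z) → T (A G y E b j z) ⊎ T (A G y E (not b) j z)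
    A-cover′ j z true yz = A-cover j z yz
    A-cover′ j z false yz = swap (A-cover j z yz)

    part2 : Part2 G y E s̄
    part2 i = (λ z yz → A-cover i z yz , λ (A′z , A″z) → A-disjoint i z A′z A″z)
            , count-A true i , count-A false i

    no-triangle-on-A-edge : ∀ {x i u v w} → T (A G y E x i u) → T (A G y E x i v) → T (adj u v) →
      T (adj u w) → T (adj v w) → ¬ T (dist2 G y w)
    no-triangle-on-A-edge {x} {i} Au Av uv uw vw yw =
      dist2⇒¬adj G yw (subst (λ q → T (adj y q))
        (common-neighbour-unique uv (A⇒adj Au) (A⇒adj Av) (adj-sym G uw) (adj-sym G vw)) (pt-in x i))

    part3 : Part3 G y E
    part3 u v w yu yv yw uv vw uw with A-cover i₀ u yu | A-cover i₀ v yv | A-cover i₀ w yw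
      where
      i₀ : Fin s
      i₀ = subst Fin (sym s≡1+[s∸1]) zero
    ... | inj₁ Au | inj₁ Av | _ = no-triangle-on-A-edge Au Av uv uw vw yw
    ... | inj₂ Au | inj₂ Av | _ = no-triangle-on-A-edge Au Av uv uw vw yw
    ... | inj₁ Au | inj₂ _ | inj₁ Aw = no-triangle-on-A-edge Au Aw uw uv (adj-sym G vw) yv
    ... | inj₂ Au | inj₁ _ | inj₂ Aw = no-triangle-on-A-edge Au Aw uw uv (adj-sym G vw) yv
    ... | inj₁ _ | inj₂ Av | inj₂ Aw = no-triangle-on-A-edge Av Aw vw (adj-sym G uv) (adj-sym G uw) yu
    ... | inj₂ _ | inj₁ Av | inj₁ Aw = no-triangle-on-A-edge Av Aw vw (adj-sym G uv) (adj-sym G uw) yu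

    A-edge-side-unique : ∀ {x i x′ i′ u v} → T (adj u v) →
      EdgeSub G (A G y E x i) (u , v) → EdgeSub G (A G y E x′ i′) (u , v) → x ≡ x′ × i ≡ i′
    A-edge-side-unique {x} {i} {x′} {i′} uv (Au , Av) (A′u , A′v) =
      pt-inj x i x′ i′ (common-neighbour-unique uv (A⇒adj Au) (A⇒adj Av) (A⇒adj A′u) (A⇒adj A′v))

    dist2-edge-in-unique-A : ∀ u v → EdgeIn G (dist2 G y) (u , v) →
      Σ Bool λ x → Σ (Fin s) λ i → EdgeSub G (A G y E x i) (u , v)
        × (∀ x′ i′ → EdgeSub G (A G y E x′ i′) (u , v) → x′ ≡ x × i′ ≡ i)
    dist2-edge-in-unique-A u v (yu , yv , uv) with dist2-edge-has-common-dist1-neighbour yu yv uv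
    ... | a , ya , au , av with cover a ya
    ... | x , i , refl = x , i , (∧⁺ yu au , ∧⁺ yv av) ,
      λ x′ i′ A′uv → A-edge-side-unique uv A′uv (∧⁺ yu au , ∧⁺ yv av)

    part4 : Part4 G y E
    part4 = dist2-edge-in-unique-A , λ x i → outerNeighbours-partition (pt-in x i)

    count-opposite-neighbours : ∀ {i p} → T (A G y E true i p) →
      count (λ w → A G y E false i w ∧ adj p w) ≡ s ∸ 1
    count-opposite-neighbours {i} {p} A′p = suc-injective (begin
      suc (count R)                                      ≡⟨ cong₂ _+_ one-in-A′ rest-in-A″ ⟨
      count (λ w → N₂ w ∧ A′ w) + count (λ w → N₂ w ∧ not (A′ w)) ≡⟨ count-split N₂ A′ ⟨
      count N₂                                           ≡⟨ nbr2-2 y p (A⇒dist2 A′p) ⟩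
      s                                                  ≡⟨ s≡1+[s∸1] ⟩
      suc (s ∸ 1)                                        ∎)
      where
      open ≡-Reasoning
      A′ A″ R N₂ : Fin n → Bool
      A′ = A G y E true i
      A″ = A G y E false i
      R w = A″ w ∧ adj p w
      N₂ w = adj p w ∧ dist2 G y w
      one-in-A′ : count (λ w → N₂ w ∧ A′ w) ≡ 1
      one-in-A′ = trans
        (count-ext {q = λ w → adj p w ∧ A′ w}
          (λ w t → ∧⁺ (∧⁻ˡ {adj p w} (∧⁻ˡ {N₂ w} t)) (∧⁻ʳ {N₂ w} t))
          (λ w t → ∧⁺ (∧⁺ (∧⁻ˡ {adj p w} t) (A⇒dist2 (∧⁻ʳ {adj p w} t))) (∧⁻ʳ {adj p w} t)))
        (outerNeighbours-matching (pt-in true i) p A′p)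
      rest-in-A″ : count (λ w → N₂ w ∧ not (A′ w)) ≡ count R
      rest-in-A″ = count-ext
        (λ w t → let pw = ∧⁻ˡ {adj p w} (∧⁻ˡ {N₂ w} t) ; yw = ∧⁻ʳ {adj p w} (∧⁻ˡ {N₂ w} t) in
           ∧⁺ (¬A′⇒A″ yw (not⁻ (∧⁻ʳ {N₂ w} t))) pw)
        (λ w t → let A″w = ∧⁻ˡ {A″ w} t in
           ∧⁺ (∧⁺ (∧⁻ʳ {A″ w} t) (A⇒dist2 A″w)) (not⁺ (λ A′w → A-disjoint i w A′w A″w)))

    -- Matching partners in A″ send the s − 1 neighbours of p in A″ to non-neighbours of p (no
    -- triangles in Λ₂), of which there are also s − 1; so r is the partner of a neighbour of p.
    crossing : ∀ {i p r u} → T (A G y E true i p) → T (A G y E false i r) → T (A G y E false i u) →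
      T (adj r u) → ¬ T (adj p r) → T (adj p u)
    crossing {i} {p} {r} {u} A′p A″r A″u ru ¬pr
      with double-counting-neighbours G {Q = Q} {R = R} R→Q Q→R |R|≡|Q| r (∧⁺ A″r (not⁺ ¬pr))
      where
      A″ Q R : Fin n → Bool
      A″ = A G y E false i
      Q z = A″ z ∧ not (adj p z)
      R w = A″ w ∧ adj p w
      matching : InducesPerfectMatching G A″
      matching = outerNeighbours-matching (pt-in false i)
      R→Q : ∀ w → T (R w) → count (λ z → Q z ∧ adj w z) ≡ 1
      R→Q w Rw = trans
        (count-ext {q = λ z → adj w z ∧ A″ z}
          (λ z t → ∧⁺ (∧⁻ʳ {Q z} t) (∧⁻ˡ {A″ z} (∧⁻ˡ {Q z} t)))
          (λ z t → let wz = ∧⁻ˡ {adj w z} t ; A″z = ∧⁻ʳ {adj w z} t in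
             ∧⁺ (∧⁺ A″z (not⁺ (part3 p w z (A⇒dist2 A′p) (A⇒dist2 A″w) (A⇒dist2 A″z) pw wz))) wz))
        (matching w A″w)
        where
        A″w = ∧⁻ˡ {A″ w} Rw
        pw = ∧⁻ʳ {A″ w} Rw
      Q→R : ∀ z → T (Q z) → count (λ w → R w ∧ adj z w) ≤ 1
      Q→R z Qz = ≤-trans
        (count-mono {q = λ w → adj z w ∧ A″ w} (λ w t → ∧⁺ (∧⁻ʳ {R w} t) (∧⁻ˡ {A″ w} (∧⁻ˡ {R w} t))))
        (≤-reflexive (matching z (∧⁻ˡ {A″ z} Qz)))
      |R|≡|Q| : count R ≡ count Q
      |R|≡|Q| = trans (count-opposite-neighbours A′p) (sym (+-cancelˡ-≡ (s ∸ 1) _ _ (begin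
        s ∸ 1 + count Q      ≡⟨ cong (_+ count Q) (count-opposite-neighbours A′p) ⟨
        count R + count Q    ≡⟨ count-split A″ (adj p) ⟨
        count A″             ≡⟨ count-A false i ⟩
        s̄                    ≡⟨ s̄≡2*[s∸1] ⟩
        2 * (s ∸ 1)          ≡⟨ cong (s ∸ 1 +_) (+-identityʳ (s ∸ 1)) ⟩
        s ∸ 1 + (s ∸ 1)      ∎)))
        where open ≡-Reasoning
    ... | w , Rw , rw = subst (λ q → T (adj p q))
            (partner-unique G (outerNeighbours-matching (pt-in false i)) A″r
              (∧⁺ rw (∧⁻ˡ {A G y E false i w} Rw)) (∧⁺ ru A″u))
            (∧⁻ʳ {A G y E false i w} Rw)

    SquareCompletion : Edge G → Edge G → Set
    SquareCompletion α′ α″ = Σ (Edge G) λ β′ → Σ (Edge G) λ β″ →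
        (EdgeIn G (dist2 G y) β′ × EdgeIn G (dist2 G y) β″ × Square G α′ α″ β′ β″)
      × (∀ γ′ γ″ → EdgeIn G (dist2 G y) γ′ → EdgeIn G (dist2 G y) γ″ → Square G α′ α″ γ′ γ″ →
           (_≈E_ G γ′ β′ × _≈E_ G γ″ β″) ⊎ (_≈E_ G γ′ β″ × _≈E_ G γ″ β′))
      × Σ (Fin s) (λ j → Split G y E j β′ β″ × (∀ j′ → Split G y E j′ β′ β″ → j′ ≡ j))

    module SquareAcross {i v₀ v₁ v₂ v₃}
      (A′v₀ : T (A G y E true i v₀)) (A′v₁ : T (A G y E true i v₁))
      (A″v₂ : T (A G y E false i v₂)) (A″v₃ : T (A G y E false i v₃))
      (v₀v₁ : T (adj v₀ v₁)) (v₁v₂ : T (adj v₁ v₂)) (v₂v₃ : T (adj v₂ v₃)) (v₃v₀ : T (adj v₃ v₀)) where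

      A′≢A″ : ∀ {u v} → T (A G y E true i u) → T (A G y E false i v) → u ≢ v
      A′≢A″ A′u A″v refl = A-disjoint i _ A′u A″v

      no-diagonal-triangle : ¬ T (adj v₁ v₃)
      no-diagonal-triangle = part3 v₁ v₂ v₃ (A⇒dist2 A′v₁) (A⇒dist2 A″v₂) (A⇒dist2 A″v₃) v₁v₂ v₂v₃

      square : ∀ {α′ α″} → _≈E_ G α′ (v₀ , v₁) → _≈E_ G α″ (v₂ , v₃) → Square G α′ α″ (v₁ , v₂) (v₃ , v₀)
      square α′≈ α″≈ = v₀ , v₁ , v₂ , v₃ ,
        (adj⇒≢ G v₀v₁ , A′≢A″ A′v₀ A″v₂ , A′≢A″ A′v₀ A″v₃ , A′≢A″ A′v₁ A″v₂ , A′≢A″ A′v₁ A″v₃ , adj⇒≢ G v₂v₃) ,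
        (v₀v₁ , v₁v₂ , v₂v₃ , v₃v₀) , (α′≈ , ≈E-refl G , α″≈ , ≈E-refl G)

      square-unique : ∀ {α′ α″} → _≈E_ G α′ (v₀ , v₁) → _≈E_ G α″ (v₂ , v₃) → ∀ γ′ γ″ → Square G α′ α″ γ′ γ″ →
        (_≈E_ G γ′ (v₁ , v₂) × _≈E_ G γ″ (v₃ , v₀)) ⊎ (_≈E_ G γ′ (v₃ , v₀) × _≈E_ G γ″ (v₁ , v₂))
      square-unique α′≈ α″≈ γ′ γ″ (w₀ , w₁ , w₂ , w₃ , _ , (_ , w₁w₂ , _ , w₃w₀) , (α′≈w , γ′≈ , α″≈w , γ″≈))
        with ≈E-trans G (≈E-sym G α′≈w) α′≈ | ≈E-trans G (≈E-sym G α″≈w) α″≈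
      ... | inj₁ (refl , refl) | inj₁ (refl , refl) = inj₁ (γ′≈ , γ″≈)
      ... | inj₁ (refl , refl) | inj₂ (refl , refl) = ⊥-elim (no-diagonal-triangle w₁w₂)
      ... | inj₂ (refl , refl) | inj₁ (refl , refl) = ⊥-elim (no-diagonal-triangle (adj-sym G w₃w₀))
      ... | inj₂ (refl , refl) | inj₂ (refl , refl) = inj₂ (≈E-flip G γ′≈ , ≈E-flip G γ″≈)

      split : ∀ x {j} → T (A G y E x j v₁) → T (A G y E x j v₂) →
        T (A G y E (not x) j v₃) → T (A G y E (not x) j v₀) → Split G y E j (v₁ , v₂) (v₃ , v₀)
      split true Av₁ Av₂ Av₃ Av₀ = inj₁ ((Av₁ , Av₂) , (Av₃ , Av₀))
      split false Av₁ Av₂ Av₃ Av₀ = inj₂ ((Av₁ , Av₂) , (Av₃ , Av₀))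

      split-index : Σ (Fin s) λ j →
        Split G y E j (v₁ , v₂) (v₃ , v₀) × (∀ j′ → Split G y E j′ (v₁ , v₂) (v₃ , v₀) → j′ ≡ j)
      split-index with dist2-edge-in-unique-A v₁ v₂ (A⇒dist2 A′v₁ , A⇒dist2 A″v₂ , v₁v₂)
      ... | x , j , (Av₁ , Av₂) , _ = j , split x Av₁ Av₂ opposite₃ opposite₀ , index-unique
        where
        opposite₀ : T (A G y E (not x) j v₀)
        opposite₀ with A-cover′ j v₀ x (A⇒dist2 A′v₀)
        ... | inj₂ A¬v₀ = A¬v₀
        ... | inj₁ Av₀ with A-edge-side-unique v₀v₁ (Av₀ , Av₁) (A′v₀ , A′v₁)
        ... | x≡true , j≡i = ⊥-elim (A-disjoint i v₂ (subst₂ (λ x j → T (A G y E x j v₂)) x≡true j≡i Av₂) A″v₂)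
        opposite₃ : T (A G y E (not x) j v₃)
        opposite₃ with A-cover′ j v₃ x (A⇒dist2 A″v₃)
        ... | inj₂ A¬v₃ = A¬v₃
        ... | inj₁ Av₃ with A-edge-side-unique v₂v₃ (Av₂ , Av₃) (A″v₂ , A″v₃)
        ... | x≡false , j≡i = ⊥-elim (A-disjoint i v₁ A′v₁ (subst₂ (λ x j → T (A G y E x j v₁)) x≡false j≡i Av₁))
        index-unique : ∀ j′ → Split G y E j′ (v₁ , v₂) (v₃ , v₀) → j′ ≡ j
        index-unique j′ (inj₁ (A′v₁v₂ , _)) = proj₂ (A-edge-side-unique v₁v₂ A′v₁v₂ (Av₁ , Av₂))
        index-unique j′ (inj₂ (A″v₁v₂ , _)) = proj₂ (A-edge-side-unique v₁v₂ A″v₁v₂ (Av₁ , Av₂))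

      completion : ∀ {α′ α″} → _≈E_ G α′ (v₀ , v₁) → _≈E_ G α″ (v₂ , v₃) → SquareCompletion α′ α″
      completion α′≈ α″≈ = (v₁ , v₂) , (v₃ , v₀) ,
        ((A⇒dist2 A′v₁ , A⇒dist2 A″v₂ , v₁v₂) , (A⇒dist2 A″v₃ , A⇒dist2 A′v₀ , v₃v₀) , square α′≈ α″≈) ,
        (λ γ′ γ″ _ _ → square-unique α′≈ α″≈ γ′ γ″) ,
        split-index

    part5 : Part5 G y E
    part5 i (p , q) (r , u) (A′p , A′q , pq) (A″r , A″u , ru) with T? (adj p r)
    ... | yes pr =
      SquareAcross.completion A′q A′p A″r A″u (adj-sym G pq) pr ru uq (inj₂ (refl , refl)) (≈E-refl G)
      where
      uq = adj-sym G (crossing A′q A″r A″u ru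
             (λ qr → part3 p q r (A⇒dist2 A′p) (A⇒dist2 A′q) (A⇒dist2 A″r) pq qr pr))
    ... | no ¬pr = SquareAcross.completion A′p A′q A″r A″u pq qr ru (adj-sym G pu) (≈E-refl G) (≈E-refl G)
      where
      pu = crossing A′p A″r A″u ru ¬pr
      qr : T (adj q r)
      qr with T? (adj q r)
      ... | yes qr = qr
      ... | no ¬qr = ⊥-elim (part3 p q u (A⇒dist2 A′p) (A⇒dist2 A′q) (A⇒dist2 A″u)
                                    pq (crossing A′q A″r A″u ru ¬qr) pu)

proposition7 : ∀ {n : ℕ} (G : SimpleGraph n) (s s̄ : ℕ) → IsExtensible G 1 s s̄ → (y : Fin n) →
    Σ (EdgePartition G (dist1 G y) s) λ E →
      (s̄ ≡ 2 * (s ∸ 1)) × Part2 G y E s̄ × Part3 G y E × Part4 G y E × Part5 G y E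
proposition7 G s s̄ ext y = dist1-partition y , s̄≡2*[s∸1] , part2 , part3 , part4 , part5
  where
  open Extensible G ext
  open Layers y (dist1-partition y)
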